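{- Let $G$ be a structured graph and $H$ a bridgeless canonical 2-edge cover of $G$. Let $A$ and $B$ be adjacent nodes of the component graph $\hat G_H$ such that $A$ is a trivial segment. Then $G$ contains a matching of size 3 each of whose edges joins a vertex of $V(C_A)$ to a vertex of $V(C_B)$.
   Context: A 2-edge cover of $G$ is a spanning subgraph with all degrees at least 2; bridgeless means all its components are 2-edge-connected; canonical (for bridgeless covers) means each component is a cycle on $i$ vertices with $4\le i\le7$ or has at least 8 edges. The component graph $\hat G_H$ is obtained from $G$ by contracting the vertex set of each component of $H$ into a single node and deleting self-loops; $C_A$ denotes the component of $H$ corresponding to node $A$. A non-trivial segment is a maximal 2-node-connected subgraph of $\hat G_H$ with at least 3 nodes; a trivial segment is a single node not in any non-trivial segment. Structured: for $\alpha\ge1$, a 2EC subgraph $C$ of a 2EC graph $G$ is $\alpha$-contractible if every spanning 2EC subgraph of $G$ contains at least $\frac1\alpha|E(C)|$ edges with both endpoints in $V(C)$; an edge $uv$ is irrelevant if $\{u,v\}$ is a 2-vertex cut; a 2-vertex cut $\{u,v\}$ is non-isolating unless $G\setminus\{u,v\}$ has exactly two components one of which is a single vertex; a 3-vertex cut $\{u,v,w\}$ is large unless $G\setminus\{u,v,w\}$ has exactly two components one of which has at most 6 vertices. $G$ is $(\alpha,\varepsilon)$-structured if simple, without cut vertex, with at least $4/\varepsilon$ vertices, and without $\alpha$-contractible subgraphs of size at most $2/\varepsilon$, irrelevant edges, non-isolating 2-vertex cuts and large 3-vertex cuts. "Structured" means $(\frac54,\varepsilon)$-structured for a fixed $\varepsilon\in(0,\frac1{24}]$.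 -}

module Defs where

open import Data.Nat using (ℕ; zero; suc; _+_; _*_; _≤_; _<_; _<ᵇ_)
open import Data.Fin using (Fin; toℕ)
open import Data.Bool using (Bool; true; false; T; if_then_else_; _∧_)
open import Data.List using (List; map; allFin)
open import Data.Nat.ListAction using (sum)
open import Data.Unit using (⊤)
open import Data.Product using (Σ; ∃; ∃-syntax; _×_; _,_; proj₁; proj₂)
open import Data.Sum using (_⊎_)
open import Data.Empty using (⊥)
open import Relation.Nullary using (¬_)
open import Relation.Binary.PropositionalEquality using (_≡_; _≢_)
open import Function.Definitions using (Injective)
open import Data.Integer using (+_)
open import Data.Rational using (ℚ; _/_) renaming (_≤_ to _≤ℚ_; _<_ to _<ℚ_; _*_ to _*ℚ_; 0ℚ to 0ℚ)

record Graph (n : ℕ) : Set where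
  field
    adj    : Fin n → Fin n → Bool
    sym    : ∀ u v → adj u v ≡ adj v u
    irrefl : ∀ v → adj v v ≡ false
open Graph public

Edge : ∀ {n} → Graph n → Fin n → Fin n → Set
Edge G u v = T (adj G u v)

SpanningSub : ∀ {n} → Graph n → Graph n → Set
SpanningSub {n} H G = ∀ (u v : Fin n) → Edge H u v → Edge G u v

countV : ∀ {n} → (Fin n → Bool) → ℕ
countV {n} P = sum (map (λ v → if P v then 1 else 0) (allFin n))

countE : ∀ {n} → (Fin n → Fin n → Bool) → ℕ
countE {n} P =
  sum (map (λ u → sum (map (λ v → if (toℕ u <ᵇ toℕ v) ∧ P u v then 1 else 0)
                           (allFin n)))
           (allFin n))

degree : ∀ {n} → Graph n → Fin n → ℕ
degree {n} H v = countV (adj H v)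

data Reach {n : ℕ} (R : Fin n → Fin n → Set) : Fin n → Fin n → Set where
  here : ∀ {u} → Reach R u u
  step : ∀ {u w v} → R u w → Reach R w v → Reach R u v

Connected : ∀ {n} → (Fin n → Set) → (Fin n → Fin n → Set) → Set
Connected {n} S E = ∀ (u v : Fin n) → S u → S v → Reach E u v

deleteEdge : ∀ {n} → (Fin n → Fin n → Set) → Fin n → Fin n → Fin n → Fin n → Set
deleteEdge E x y u v = E u v × ¬ (u ≡ x × v ≡ y) × ¬ (u ≡ y × v ≡ x)

TwoEC : ∀ {n} → (Fin n → Set) → (Fin n → Fin n → Set) → Set
TwoEC {n} S E =
  (∃[ u ] ∃[ v ] (S u × S v × u ≢ v))
  × Connected S E
  × (∀ (x y : Fin n) → E x y → Connected S (deleteEdge E x y))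

TwoECGraph : ∀ {n} → Graph n → Set
TwoECGraph G = TwoEC (λ _ → ⊤) (Edge G)

EdgeAvoiding : ∀ {n} → Graph n → (Fin n → Set) → Fin n → Fin n → Set
EdgeAvoiding G D u v = Edge G u v × ¬ D u × ¬ D v

CutVertex : ∀ {n} → Graph n → Fin n → Set
CutVertex G v =
  ∃[ a ] ∃[ b ] (a ≢ v × b ≢ v × Reach (Edge G) a b
                 × ¬ Reach (EdgeAvoiding G (λ x → x ≡ v)) a b)

IsVertexCut : ∀ {n} → Graph n → (Fin n → Set) → Set
IsVertexCut G D =
  ∃[ a ] ∃[ b ] (¬ D a × ¬ D b × ¬ Reach (EdgeAvoiding G D) a b)

TwoVertexCut : ∀ {n} → Graph n → Fin n → Fin n → Set
TwoVertexCut G u v = u ≢ v × IsVertexCut G (λ x → x ≡ u ⊎ x ≡ v)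

ThreeVertexCut : ∀ {n} → Graph n → Fin n → Fin n → Fin n → Set
ThreeVertexCut G u v w =
  u ≢ v × u ≢ w × v ≢ w × IsVertexCut G (λ x → x ≡ u ⊎ x ≡ v ⊎ x ≡ w)

-- G - D has exactly two components, one of which (X) has at most k vertices:
-- X is nonempty, disjoint from D, connected in G - D, has no G-edge to the
-- rest Y of G - D, and Y is nonempty and connected in G - D.
TwoCompsOneSmall : ∀ {n} → Graph n → (Fin n → Set) → ℕ → Set
TwoCompsOneSmall {n} G D k =
  Σ (Fin n → Bool) λ X →
    let InX = λ x → T (X x)
        InY = λ x → ¬ D x × ¬ T (X x)
    in (∃[ x ] InX x)
     × (∀ x → InX x → ¬ D x)
     × Connected InX (EdgeAvoiding G D)
     × (∀ x y → InX x → InY y → ¬ Edge G x y)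
     × (∃[ y ] InY y)
     × Connected InY (EdgeAvoiding G D)
     × countV X ≤ k

record Sub2EC {n : ℕ} (G : Graph n) : Set where
  field
    VC    : Fin n → Bool
    EC    : Graph n
    ECsub : SpanningSub EC G
    ECin  : ∀ u v → Edge EC u v → T (VC u) × T (VC v)
    is2EC : TwoEC (λ v → T (VC v)) (Edge EC)
open Sub2EC public

Contractible54 : ∀ {n} (G : Graph n) → Sub2EC G → Set
Contractible54 {n} G C =
  ∀ (F : Graph n) → SpanningSub F G → TwoECGraph F →
    4 * countE (adj (EC C)) ≤ 5 * countE (λ u v → adj F u v ∧ VC C u ∧ VC C v)

ℕtoℚ : ℕ → ℚ
ℕtoℚ m = + m / 1

Structured : ∀ {n} → ℚ → Graph n → Set
Structured {n} ε G =
  -- simple: built into Graph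
  (∀ v → ¬ CutVertex G v)
  × (+ 4 / 1 ≤ℚ ε *ℚ ℕtoℚ n)
  × (∀ (C : Sub2EC G) → ε *ℚ ℕtoℚ (countV (VC C)) ≤ℚ + 2 / 1
       → ¬ Contractible54 G C)
  × (∀ u v → Edge G u v → ¬ TwoVertexCut G u v)
  × (∀ u v → TwoVertexCut G u v
       → TwoCompsOneSmall G (λ x → x ≡ u ⊎ x ≡ v) 1)
  × (∀ u v w → ThreeVertexCut G u v w
       → TwoCompsOneSmall G (λ x → x ≡ u ⊎ x ≡ v ⊎ x ≡ w) 6)

SameComp : ∀ {n} → Graph n → Fin n → Fin n → Set
SameComp H u v = Reach (Edge H) u v

CompV : ∀ {n} → Graph n → Fin n → Fin n → Set
CompV H a v = SameComp H a v

CompE : ∀ {n} → Graph n → Fin n → Fin n → Fin n → Set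
CompE H a u v = Edge H u v × CompV H a u × CompV H a v

TwoEdgeCover : ∀ {n} → Graph n → Graph n → Set
TwoEdgeCover G H = SpanningSub H G × (∀ v → 2 ≤ degree H v)

Bridgeless : ∀ {n} → Graph n → Set
Bridgeless H = ∀ a → TwoEC (CompV H a) (CompE H a)

suc-mod : ∀ {i} → Fin i → Fin i → Set
suc-mod {i} p q = (toℕ q ≡ suc (toℕ p)) ⊎ (suc (toℕ p) ≡ i × toℕ q ≡ 0)

CompIsCycle : ∀ {n} → Graph n → Fin n → ℕ → Set
CompIsCycle {n} H a i =
  Σ (Fin i → Fin n) λ f →
    Injective _≡_ _≡_ f
    × (∀ v → CompV H a v → ∃[ p ] f p ≡ v)
    × (∀ p → CompV H a (f p))
    × (∀ p q → Edge H (f p) (f q) → suc-mod p q ⊎ suc-mod q p)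
    × (∀ p q → suc-mod p q → Edge H (f p) (f q))

CompAtLeast8Edges : ∀ {n} → Graph n → Fin n → Set
CompAtLeast8Edges {n} H a =
  Σ (Fin 8 → Fin n × Fin n) λ f →
    Injective _≡_ _≡_ f
    × (∀ k → toℕ (proj₁ (f k)) < toℕ (proj₂ (f k))
             × CompE H a (proj₁ (f k)) (proj₂ (f k)))

Canonical : ∀ {n} → Graph n → Set
Canonical H = ∀ a → (∃[ i ] (4 ≤ i × i ≤ 7 × CompIsCycle H a i))
                    ⊎ CompAtLeast8Edges H a

-- A node is represented by any vertex of the
-- corresponding component (two representatives denote the same node iff
-- SameComp).

NodeAdj : ∀ {n} → Graph n → Graph n → Fin n → Fin n → Set
NodeAdj G H a b =
  ¬ SameComp H a b
  × ∃[ x ] ∃[ y ] (SameComp H a x × SameComp H b y × Edge G x y)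

-- a set of nodes: a predicate on representatives closed under SameComp
Saturated : ∀ {n} → Graph n → (Fin n → Set) → Set
Saturated H X = ∀ u v → X u → SameComp H u v → X v

NodeStep : ∀ {n} → Graph n → Graph n → (Fin n → Set) → Fin n → Fin n → Set
NodeStep G H X p q = X p × X q × (SameComp H p q ⊎ NodeAdj G H p q)

NodeConnected : ∀ {n} → Graph n → Graph n → (Fin n → Set) → Set
NodeConnected G H X = ∀ u v → X u → X v → Reach (NodeStep G H X) u v

removeNode : ∀ {n} → Graph n → (Fin n → Set) → Fin n → Fin n → Set
removeNode H X c v = X v × ¬ SameComp H c v

TwoNodeConn3 : ∀ {n} → Graph n → Graph n → (Fin n → Set) → Set
TwoNodeConn3 G H X =
  (∃[ u ] ∃[ v ] ∃[ w ] (X u × X v × X w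
     × ¬ SameComp H u v × ¬ SameComp H u w × ¬ SameComp H v w))
  × NodeConnected G H X
  × (∀ c → X c → NodeConnected G H (removeNode H X c))

NonTrivialSegment : ∀ {n} → Graph n → Graph n → (Fin n → Set) → Set₁
NonTrivialSegment {n} G H X =
  Saturated H X
  × TwoNodeConn3 G H X
  × (∀ (Y : Fin n → Set) → Saturated H Y → TwoNodeConn3 G H Y
       → (∀ v → X v → Y v) → ∀ v → Y v → X v)

TrivialSegment : ∀ {n} → Graph n → Graph n → Fin n → Set₁
TrivialSegment {n} G H a =
  ∀ (X : Fin n → Set) → NonTrivialSegment G H X → ¬ X a

Matching3Between : ∀ {n} → Graph n → Graph n → Fin n → Fin n → Set
Matching3Between {n} G H a b =
  Σ (Fin 3 → Fin n) λ x → Σ (Fin 3 → Fin n) λ y →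
    (∀ k → Edge G (x k) (y k) × SameComp H a (x k) × SameComp H b (y k))
    × Injective _≡_ _≡_ x
    × Injective _≡_ _≡_ y
    × (∀ k l → x k ≢ y l)

-- If there is no such matching, Kőnig's theorem gives at most two vertices D covering every
-- edge between C_A and C_B.  Removing D separates C_A from C_B: a walk from C_A to C_B in G − D,
-- cut at its last visit to each node, becomes a path of nodes of \hat G_H that is either a
-- single edge AB avoiding D, impossible as D covers these edges, or closes with the edge AB
-- into a cycle through A, impossible as A is a trivial segment.  Since C_A and C_B have at
-- least four vertices each, D is then a cut vertex or a 2-vertex cut leaving vertices of both
-- C_A and C_B outside its isolated vertex, and a structured graph has neither.

module Submission where

open import Defs hiding (sym)
open import Data.Nat as ℕ using (ℕ; zero; suc; _*_; z≤n; s≤s)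
open import Data.Nat.Properties using (m≤n+m; n<1+n; <-trans; <-irrefl; ≤-trans)
open import Data.Nat.ListAction using (sum)
open import Data.List.Properties using (map-tabulate)
open import Data.Bool using (Bool; true; T; if_then_else_)
open import Data.Fin using (Fin; zero; suc; toℕ; punchIn; punchOut; combine; remQuot)
open import Data.Fin.Properties using (any?; all?; pigeonhole; <⇒≢; punchIn-punchOut; remQuot-combine)
  renaming (_≟_ to _≟ᶠ_)
open import Data.Fin.Subset using (Subset; _∈_; _⊃_; ⁅_⁆; _∪_; inside; outside)
open import Data.Fin.Subset.Properties using (_∈?_; x∈⁅x⁆; x∈⁅y⁆⇒x≡y; x∈p∪q⁺; x∈p∪q⁻; q⊆p∪q)
open import Data.Fin.Subset.Induction using (⊃-wellFounded)
import Data.Vec as Vec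
open Vec using (here; there)
open import Data.Vec.Functional using ([]; _∷_)
open import Data.Integer using (+_)
open import Data.Rational using (ℚ; _/_; _<_; _≤_; 0ℚ)
open import Data.Product using (Σ; ∃; ∃₂; _×_; _,_; proj₁; proj₂)
open import Data.Product.Properties using (≡-dec)
open import Data.Sum using (_⊎_; inj₁; inj₂; [_,_]′; map₂) renaming (swap to ⊎-swap; map to ⊎-map)
open import Data.Empty using (⊥; ⊥-elim)
open import Function using (_∘_; id; _⇔_; mk⇔; Equivalence)
open import Function.Definitions using (Injective)
open import Induction.WellFounded using (Acc; acc)
open import Relation.Binary using (DecidableEquality) renaming (Decidable to Decidable₂)
open import Relation.Unary using (Decidable)
open import Relation.Nullary using (¬_; Dec; yes; no; ¬?; _×-dec_; _⊎-dec_; contradiction)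
open import Relation.Nullary.Decidable using (T?; ¬¬-excluded-middle)
open import Relation.Binary.PropositionalEquality
  using (_≡_; _≢_; refl; sym; trans; cong; cong₂; subst; ≢-sym; module ≡-Reasoning)

module _ {n : ℕ} {R : Fin n → Fin n → Set} where

  reach-trans : ∀ {u v w} → Reach R u v → Reach R v w → Reach R u w
  reach-trans here       q = q
  reach-trans (step r p) q = step r (reach-trans p q)

  reach-snoc : ∀ {u v w} → Reach R u v → R v w → Reach R u w
  reach-snoc p r = reach-trans p (step r here)

  reach-reverse : (∀ {u v} → R u v → R v u) → ∀ {u v} → Reach R u v → Reach R v u
  reach-reverse R-sym here       = here
  reach-reverse R-sym (step r p) = reach-snoc (reach-reverse R-sym p) (R-sym r)

  connected-via : (∀ {u v} → R u v → R v u) → ∀ {X : Fin n → Set} r → (∀ u → X u → Reach R u r) →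
                  ∀ u v → X u → X v → Reach R u v
  connected-via R-sym r to-r u v Xu Xv = reach-trans (to-r u Xu) (reach-reverse R-sym (to-r v Xv))

module _ {n : ℕ} {R S : Fin n → Fin n → Set} where

  reach-concatMap : (∀ {u v} → R u v → Reach S u v) → ∀ {u v} → Reach R u v → Reach S u v
  reach-concatMap f here       = here
  reach-concatMap f (step r p) = reach-trans (f r) (reach-concatMap f p)

  reach-map : (∀ {u v} → R u v → S u v) → ∀ {u v} → Reach R u v → Reach S u v
  reach-map f = reach-concatMap (λ r → step (f r) here)

module _ {n : ℕ} {R : Fin n → Fin n → Set} (R? : Decidable₂ R) where

  ClosedUnder : Subset n → Set
  ClosedUnder s = ∀ {x y} → x ∈ s → R x y → y ∈ s

  closed-reach : ∀ {s x y} → ClosedUnder s → x ∈ s → Reach R x y → y ∈ s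
  closed-reach closed x∈s here       = x∈s
  closed-reach closed x∈s (step r p) = closed-reach closed (closed x∈s r) p

  reachable-closure : ∀ u s → Acc _⊃_ s → u ∈ s → (∀ {v} → v ∈ s → Reach R u v) →
                      ∃ λ t → ClosedUnder t × u ∈ t × (∀ {v} → v ∈ t → Reach R u v)
  reachable-closure u s (acc grow) u∈s s-reach
    with any? (λ x → any? (λ y → x ∈? s ×-dec R? x y ×-dec ¬? (y ∈? s)))
  ... | no none = s , closed , u∈s , s-reach
    where
    closed : ClosedUnder s
    closed {x} {y} x∈s r with y ∈? s
    ... | yes y∈s = y∈s
    ... | no  y∉s = contradiction (x , y , x∈s , r , y∉s) none
  ... | yes (x , y , x∈s , r , y∉s) =
    reachable-closure u (⁅ y ⁆ ∪ s) (grow (q⊆p∪q ⁅ y ⁆ s , y , x∈p∪q⁺ (inj₁ (x∈⁅x⁆ y)) , y∉s))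
                      (x∈p∪q⁺ (inj₂ u∈s)) reach
    where
    reach : ∀ {v} → v ∈ ⁅ y ⁆ ∪ s → Reach R u v
    reach {v} v∈ with x∈p∪q⁻ ⁅ y ⁆ s v∈
    ... | inj₁ v∈⁅y⁆ rewrite x∈⁅y⁆⇒x≡y y v∈⁅y⁆ = reach-snoc (s-reach x∈s) r
    ... | inj₂ v∈s = s-reach v∈s

  reach? : Decidable₂ (Reach R)
  reach? u v
    with reachable-closure u ⁅ u ⁆ (⊃-wellFounded _) (x∈⁅x⁆ u)
           (λ v∈ → subst (Reach R u) (sym (x∈⁅y⁆⇒x≡y u v∈)) here)
  ... | t , closed , u∈t , t-reach with v ∈? t
  ... | yes v∈t = yes (t-reach v∈t)
  ... | no  v∉t = no (v∉t ∘ closed-reach closed u∈t)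

¬¬-subset : ∀ {ℓ n} (P : Fin n → Set ℓ) → ¬ ¬ (Σ (Subset n) λ s → ∀ v → v ∈ s ⇔ P v)
¬¬-subset {n = zero}  P k = k (Vec.[] , λ ())
¬¬-subset {n = suc n} P k =
  ¬¬-excluded-middle λ P0? → ¬¬-subset (P ∘ suc) λ (s , s⇔P) → k (extend P0? s s⇔P)
  where
  extend : Dec (P zero) → (s : Subset n) → (∀ v → v ∈ s ⇔ P (suc v)) →
           Σ (Subset (suc n)) λ t → ∀ v → v ∈ t ⇔ P v
  extend (yes P0) s s⇔P = inside Vec.∷ s , λ where
    zero    → mk⇔ (λ _ → P0) (λ _ → here)
    (suc v) → mk⇔ (λ { (there v∈s) → Equivalence.to (s⇔P v) v∈s })
                  (there ∘ Equivalence.from (s⇔P v))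
  extend (no ¬P0) s s⇔P = outside Vec.∷ s , λ where
    zero    → mk⇔ (λ ()) (λ P0 → contradiction P0 ¬P0)
    (suc v) → mk⇔ (λ { (there v∈s) → Equivalence.to (s⇔P v) v∈s })
                  (there ∘ Equivalence.from (s⇔P v))

escape : ∀ {A : Set} {m k} → DecidableEquality A → (f : Fin m → A) → Injective _≡_ _≡_ f →
         (ps : Fin k → A) → k ℕ.< m → ∃ λ i → ∀ j → f i ≢ ps j
escape _≟_ f f-inj ps k<m with any? (λ i → all? (λ j → ¬? (f i ≟ ps j)))
... | yes found = found
... | no none = let (i , j , i<j , same) = pigeonhole k<m (proj₁ ∘ hit) in
                ⊥-elim (collision (<⇒≢ i<j) same)
  where
  hit : ∀ i → ∃ λ j → f i ≡ ps j
  hit i with any? (λ j → f i ≟ ps j)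
  ... | yes h = h
  ... | no ¬h = contradiction (i , λ j e → ¬h (j , e)) none
  collision : ∀ {i j} → i ≢ j → proj₁ (hit i) ≢ proj₁ (hit j)
  collision {i} {j} i≢j same =
    i≢j (f-inj (trans (proj₂ (hit i)) (trans (cong ps same) (sym (proj₂ (hit j))))))

-- The (k+1)k ordered pairs (ps i , ps j) with i ≢ j.
offDiagonal : ∀ {A : Set} {k} → (Fin (suc k) → A) → Fin (suc k * k) → A × A
offDiagonal {k = k} ps = (λ (i , j) → ps i , ps (punchIn i j)) ∘ remQuot k

offDiagonal-combine : ∀ {A : Set} {k} (ps : Fin (suc k) → A) {i j} (i≢j : i ≢ j) →
                      offDiagonal ps (combine i (punchOut i≢j)) ≡ (ps i , ps j)
offDiagonal-combine ps {i} {j} i≢j = begin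
  offDiagonal ps (combine i (punchOut i≢j))
    ≡⟨ cong (λ (i , j) → ps i , ps (punchIn i j)) (remQuot-combine i _) ⟩
  ps i , ps (punchIn i (punchOut i≢j))
    ≡⟨ cong (λ j → ps i , ps j) (punchIn-punchOut i≢j) ⟩
  ps i , ps j
    ∎
  where open ≡-Reasoning

pair-escape : ∀ {A : Set} {m k} → DecidableEquality A → (f : Fin m → A × A) → Injective _≡_ _≡_ f →
              (∀ e → proj₁ (f e) ≢ proj₂ (f e)) → (ps : Fin (suc k) → A) → suc k * k ℕ.< m →
              ∃ λ e → (∀ j → proj₁ (f e) ≢ ps j) ⊎ (∀ j → proj₂ (f e) ≢ ps j)
pair-escape _≟_ f f-inj loopless ps bound
  with escape (≡-dec _≟_ _≟_) f f-inj (offDiagonal ps) bound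
... | e , f≢ with any? (λ i → proj₁ (f e) ≟ ps i) | any? (λ j → proj₂ (f e) ≟ ps j)
... | no ¬u | _     = e , inj₁ (λ j eq → ¬u (j , eq))
... | yes _ | no ¬v = e , inj₂ (λ j eq → ¬v (j , eq))
... | yes (i , u≡) | yes (j , v≡) =
  ⊥-elim (f≢ (combine i (punchOut i≢j)) (trans (cong₂ _,_ u≡ v≡) (sym (offDiagonal-combine ps i≢j))))
  where
  i≢j : i ≢ j
  i≢j refl = loopless e (trans u≡ (sym v≡))

countV-suc : ∀ {n} (P : Fin (suc n) → Bool) →
             countV P ≡ (if P zero then 1 else 0) ℕ.+ countV (P ∘ suc)
countV-suc P = cong ((if P zero then 1 else 0) ℕ.+_)
  (cong sum (trans (map-tabulate suc (λ v → if P v then 1 else 0))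
                   (sym (map-tabulate (λ v → v) (λ v → if P (suc v) then 1 else 0)))))

countV-tail : ∀ {n} (P : Fin (suc n) → Bool) → countV (P ∘ suc) ℕ.≤ countV P
countV-tail P rewrite countV-suc P = m≤n+m _ _

countV-pos : ∀ {n} (P : Fin n → Bool) {v} → T (P v) → 1 ℕ.≤ countV P
countV-pos P {zero} Pv rewrite countV-suc P with P zero
... | true = s≤s z≤n
countV-pos P {suc v} Pv = ≤-trans (countV-pos (P ∘ suc) Pv) (countV-tail P)

countV-head-tail : ∀ {n} (P : Fin (suc n) → Bool) {v} → T (P zero) → T (P (suc v)) → 2 ℕ.≤ countV P
countV-head-tail P P0 Pv rewrite countV-suc P with P zero
... | true = s≤s (countV-pos (P ∘ suc) Pv)

countV≤1-unique : ∀ {n} (P : Fin n → Bool) → countV P ℕ.≤ 1 → ∀ {u v} → T (P u) → T (P v) → u ≡ v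
countV≤1-unique P ≤1 {zero}  {zero}  _  _  = refl
countV≤1-unique P ≤1 {zero}  {suc v} Pu Pv = contradiction (≤-trans (countV-head-tail P Pu Pv) ≤1) λ where
  (s≤s ())
countV≤1-unique P ≤1 {suc u} {zero}  Pu Pv = contradiction (≤-trans (countV-head-tail P Pv Pu) ≤1) λ where
  (s≤s ())
countV≤1-unique P ≤1 {suc u} {suc v} Pu Pv =
  cong suc (countV≤1-unique (P ∘ suc) (≤-trans (countV-tail P) ≤1) Pu Pv)

Pair : ∀ {A : Set} → A → A → A → Set
Pair a b x = x ≡ a ⊎ x ≡ b

Distinct3 : ∀ {A : Set} → A → A → A → Set
Distinct3 a b c = a ≢ b × a ≢ c × b ≢ c

distinct3-injective : ∀ {A : Set} {a b c : A} → Distinct3 a b c → Injective _≡_ _≡_ (a ∷ b ∷ c ∷ [])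
distinct3-injective _             {zero}           {zero}           _ = refl
distinct3-injective _             {suc zero}       {suc zero}       _ = refl
distinct3-injective _             {suc (suc zero)} {suc (suc zero)} _ = refl
distinct3-injective (a≢b , _ , _) {zero}           {suc zero}       e = contradiction e a≢b
distinct3-injective (_ , a≢c , _) {zero}           {suc (suc zero)} e = contradiction e a≢c
distinct3-injective (_ , _ , b≢c) {suc zero}       {suc (suc zero)} e = contradiction e b≢c
distinct3-injective (a≢b , _ , _) {suc zero}       {zero}           e = contradiction (sym e) a≢b
distinct3-injective (_ , a≢c , _) {suc (suc zero)} {zero}           e = contradiction (sym e) a≢c
distinct3-injective (_ , _ , b≢c) {suc (suc zero)} {suc zero}       e = contradiction (sym e) b≢c

-- Kőnig's theorem for matchings of size three, in the bipartite graph whose two sides are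
-- the tails and the heads of the edges of E.
module SmallKonig {n : ℕ} {E : Fin n → Fin n → Set} (E? : Decidable₂ E) where

  record Matching3 : Set where
    constructor matching3
    field
      {x₀ x₁ x₂ y₀ y₁ y₂} : Fin n
      edge₀ : E x₀ y₀
      edge₁ : E x₁ y₁
      edge₂ : E x₂ y₂
      tails-distinct : Distinct3 x₀ x₁ x₂
      heads-distinct : Distinct3 y₀ y₁ y₂

  CoveredBy : (Fin n → Set) → (Fin n → Set) → Set
  CoveredBy P Q = ∀ {x y} → E x y → P x ⊎ Q y

  VertexCover2 : Set
  VertexCover2 = ∃₂ λ d₁ d₂ → CoveredBy (Pair d₁ d₂) (Pair d₁ d₂)

  pair? : (a b : Fin n) → Decidable (Pair a b)
  pair? a b x = x ≟ᶠ a ⊎-dec x ≟ᶠ b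

  none? : Decidable {A = Fin n} (λ _ → ⊥)
  none? _ = no id

  edge-avoiding? : ∀ {P Q : Fin n → Set} → Decidable P → Decidable Q →
                   (∃₂ λ x y → E x y × ¬ P x × ¬ Q y) ⊎ CoveredBy P Q
  edge-avoiding? P? Q? with any? (λ x → any? (λ y → E? x y ×-dec ¬? (P? x) ×-dec ¬? (Q? y)))
  ... | yes (x , y , found) = inj₁ (x , y , found)
  ... | no none = inj₂ covered
    where
    covered : CoveredBy _ _
    covered {x} {y} e with P? x | Q? y
    ... | yes Px | _     = inj₁ Px
    ... | no  _  | yes Qy = inj₂ Qy
    ... | no ¬Px | no ¬Qy = contradiction (x , y , e , ¬Px , ¬Qy) none

  -- Either x₁ and y₀ cover E, or an edge avoiding both completes a matching.
  crossing : ∀ {x₀ y₀ x₁ y₁ p s} → E x₀ y₀ → E x₁ y₁ → x₀ ≢ x₁ → y₀ ≢ y₁ → E p y₀ → E x₁ s →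
             ¬ Pair x₀ x₁ p → ¬ Pair y₀ y₁ s → CoveredBy (Pair x₀ x₁) (Pair y₀ y₁) →
             Matching3 ⊎ VertexCover2
  crossing {x₀} {y₀} {x₁} {y₁} e₀ e₁ x₀≢x₁ y₀≢y₁ ep es p∉ s∉ meets
    with edge-avoiding? (_≟ᶠ x₁) (_≟ᶠ y₀)
  ... | inj₂ covered = inj₂ (x₁ , y₀ , ⊎-map inj₁ inj₂ ∘ covered)
  ... | inj₁ (w , z , ew , w≢x₁ , z≢y₀) with w ≟ᶠ x₀ | z ≟ᶠ y₁
  ... | yes refl | yes refl =
    inj₁ (matching3 ep es ew (p∉ ∘ inj₂ , p∉ ∘ inj₁ , ≢-sym x₀≢x₁)
                             (≢-sym (s∉ ∘ inj₁) , y₀≢y₁ , s∉ ∘ inj₂))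
  ... | yes refl | no z≢y₁ =
    inj₁ (matching3 ep ew e₁ (p∉ ∘ inj₁ , p∉ ∘ inj₂ , x₀≢x₁) (≢-sym z≢y₀ , y₀≢y₁ , z≢y₁))
  ... | no w≢x₀ | _ with meets ew
  ... | inj₁ w∈ = contradiction w∈ [ w≢x₀ , w≢x₁ ]′
  ... | inj₂ (inj₁ z≡y₀) = contradiction z≡y₀ z≢y₀
  ... | inj₂ (inj₂ refl) =
    inj₁ (matching3 ew es e₀ (w≢x₁ , w≢x₀ , ≢-sym x₀≢x₁)
                             (≢-sym (s∉ ∘ inj₂) , ≢-sym y₀≢y₁ , s∉ ∘ inj₁))

  -- Some edge leaves {x₀, x₁} and some edge leaves {y₀, y₁}, unless one of these pairs
  -- covers E; as every edge meets x₀y₀ or x₁y₁, these two edges end in {y₀, y₁} and {x₀, x₁}.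
  two-disjoint-edges : ∀ {x₀ y₀ x₁ y₁} → E x₀ y₀ → E x₁ y₁ → x₀ ≢ x₁ → y₀ ≢ y₁ →
                       CoveredBy (Pair x₀ x₁) (Pair y₀ y₁) → Matching3 ⊎ VertexCover2
  two-disjoint-edges {x₀} {y₀} {x₁} {y₁} e₀ e₁ x₀≢x₁ y₀≢y₁ meets
    with edge-avoiding? (pair? x₀ x₁) none? | edge-avoiding? none? (pair? y₀ y₁)
  ... | inj₂ covered | _ = inj₂ (x₀ , x₁ , [ inj₁ , ⊥-elim ]′ ∘ covered)
  ... | inj₁ _ | inj₂ covered = inj₂ (y₀ , y₁ , [ ⊥-elim , inj₂ ]′ ∘ covered)
  ... | inj₁ (p , q , ep , p∉ , _) | inj₁ (r , s , er , _ , s∉)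
    with [ (λ p∈ → contradiction p∈ p∉) , id ]′ (meets ep)
       | [ id , (λ s∈ → contradiction s∈ s∉) ]′ (meets er)
  ... | inj₁ refl | inj₁ refl =
    inj₁ (matching3 ep er e₁ (p∉ ∘ inj₁ , p∉ ∘ inj₂ , x₀≢x₁)
                             (≢-sym (s∉ ∘ inj₁) , y₀≢y₁ , s∉ ∘ inj₂))
  ... | inj₂ refl | inj₂ refl =
    inj₁ (matching3 ep er e₀ (p∉ ∘ inj₂ , p∉ ∘ inj₁ , ≢-sym x₀≢x₁)
                             (≢-sym (s∉ ∘ inj₂) , ≢-sym y₀≢y₁ , s∉ ∘ inj₁))
  ... | inj₁ refl | inj₂ refl = crossing e₀ e₁ x₀≢x₁ y₀≢y₁ ep er p∉ s∉ meets
  ... | inj₂ refl | inj₁ refl =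
    crossing e₁ e₀ (≢-sym x₀≢x₁) (≢-sym y₀≢y₁) ep er (p∉ ∘ ⊎-swap) (s∉ ∘ ⊎-swap)
             (⊎-map ⊎-swap ⊎-swap ∘ meets)

  matching3-or-cover : ∀ {x₀ y₀} → E x₀ y₀ → Matching3 ⊎ VertexCover2
  matching3-or-cover {x₀} {y₀} e₀ with edge-avoiding? (_≟ᶠ x₀) (_≟ᶠ y₀)
  ... | inj₂ covered = inj₂ (x₀ , y₀ , ⊎-map inj₁ inj₂ ∘ covered)
  ... | inj₁ (x₁ , y₁ , e₁ , x₁≢x₀ , y₁≢y₀) with edge-avoiding? (pair? x₀ x₁) (pair? y₀ y₁)
  ... | inj₂ meets = two-disjoint-edges e₀ e₁ (≢-sym x₁≢x₀) (≢-sym y₁≢y₀) meets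
  ... | inj₁ (x₂ , y₂ , e₂ , x₂∉ , y₂∉) =
    inj₁ (matching3 e₀ e₁ e₂ (≢-sym x₁≢x₀ , ≢-sym (x₂∉ ∘ inj₁) , ≢-sym (x₂∉ ∘ inj₂))
                             (≢-sym y₁≢y₀ , ≢-sym (y₂∉ ∘ inj₁) , ≢-sym (y₂∉ ∘ inj₂)))

edge-sym : ∀ {n} (K : Graph n) {u v} → Edge K u v → Edge K v u
edge-sym K {u} {v} = subst T (Graph.sym K u v)

module ComponentGraph {n : ℕ} (G H : Graph n) where

  infix 4 _~_ _~?_
  _~_ : Fin n → Fin n → Set
  _~_ = SameComp H

  _~?_ : ∀ u v → Dec (u ~ v)
  _~?_ = reach? (λ u v → T? (adj H u v))

  ~-sym : ∀ {u v} → u ~ v → v ~ u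
  ~-sym = reach-reverse (edge-sym H)

  ~-trans : ∀ {u v w} → u ~ v → v ~ w → u ~ w
  ~-trans = reach-trans

  Adj : Fin n → Fin n → Set
  Adj = NodeAdj G H

  adj-sym : ∀ {p q} → Adj p q → Adj q p
  adj-sym (p≁q , x , y , px , qy , e) = (p≁q ∘ ~-sym) , y , x , qy , px , edge-sym G e

  adj-resp : ∀ {p p′ q q′} → p ~ p′ → q ~ q′ → Adj p q → Adj p′ q′
  adj-resp pp′ qq′ (p≁q , x , y , px , qy , e) =
    (λ p′q′ → p≁q (~-trans pp′ (~-trans p′q′ (~-sym qq′)))) ,
    x , y , ~-trans (~-sym pp′) px , ~-trans (~-sym qq′) qy , e

  Chord : Fin n → Fin n → Fin n → Fin n → Set
  Chord x y p q = (p ~ x × q ~ y) ⊎ (p ~ y × q ~ x)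

  ChordStep : Fin n → Fin n → (Fin n → Set) → Fin n → Fin n → Set
  ChordStep x y X p q = X p × X q × ((p ~ q ⊎ Adj p q) ⊎ Chord x y p q)

  ConnectedWithChord : Fin n → Fin n → (Fin n → Set) → Set
  ConnectedWithChord x y X = ∀ u v → X u → X v → Reach (ChordStep x y X) u v

  nodeStep-sym : ∀ {X p q} → NodeStep G H X p q → NodeStep G H X q p
  nodeStep-sym (Xp , Xq , inj₁ p~q)   = Xq , Xp , inj₁ (~-sym p~q)
  nodeStep-sym (Xp , Xq , inj₂ adjpq) = Xq , Xp , inj₂ (adj-sym adjpq)

  chordStep-sym : ∀ {x y X p q} → ChordStep x y X p q → ChordStep x y X q p
  chordStep-sym (Xp , Xq , inj₁ (inj₁ p~q))    = Xq , Xp , inj₁ (inj₁ (~-sym p~q))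
  chordStep-sym (Xp , Xq , inj₁ (inj₂ adjpq))   = Xq , Xp , inj₁ (inj₂ (adj-sym adjpq))
  chordStep-sym (Xp , Xq , inj₂ (inj₁ (p , q))) = Xq , Xp , inj₂ (inj₂ (q , p))
  chordStep-sym (Xp , Xq , inj₂ (inj₂ (p , q))) = Xq , Xp , inj₂ (inj₁ (q , p))

  -- \hat G_H[S] is connected, and adding the edge xy makes it 2-node-connected; for instance
  -- when S is a path of nodes from x to y.
  record TwoConnectedWithChord (x y : Fin n) (S : Fin n → Set) : Set where
    field
      saturated         : Saturated H S
      x∈                : S x
      y∈                : S y
      connected         : NodeConnected G H S
      connected-without : ∀ c → S c → ConnectedWithChord x y (removeNode H S c)

  open TwoConnectedWithChord

  NodePair : Fin n → Fin n → Fin n → Set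
  NodePair x y p = x ~ p ⊎ y ~ p

  nodePair-twoConnected : ∀ {x y} → Adj x y → TwoConnectedWithChord x y (NodePair x y)
  nodePair-twoConnected {x} {y} xy = record
    { saturated         = λ where
                              u v (inj₁ xu) uv → inj₁ (~-trans xu uv)
                              u v (inj₂ yu) uv → inj₂ (~-trans yu uv)
    ; x∈                = inj₁ here
    ; y∈                = inj₂ here
    ; connected         = λ u v Xu Xv → step (Xu , Xv , linked Xu Xv) here
    ; connected-without = λ c _ u v Xu Xv → step (Xu , Xv , inj₁ (linked (proj₁ Xu) (proj₁ Xv))) here
    }
    where
    linked : ∀ {u v} → NodePair x y u → NodePair x y v → u ~ v ⊎ Adj u v
    linked (inj₁ xu) (inj₁ xv) = inj₁ (~-trans (~-sym xu) xv)
    linked (inj₁ xu) (inj₂ yv) = inj₂ (adj-resp xu yv xy)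
    linked (inj₂ yu) (inj₁ xv) = inj₂ (adj-resp yu xv (adj-sym xy))
    linked (inj₂ yu) (inj₂ yv) = inj₁ (~-trans (~-sym yu) yv)

  -- Prepending to the path w ⋯ y the node x adjacent to w keeps the cycle closed by the chord.
  module Extend {x w y : Fin n} {S : Fin n → Set} (S-tc : TwoConnectedWithChord w y S)
                (x∉S : ¬ S x) (xw : Adj x w) (w≁y : ¬ w ~ y) where

    S⁺ : Fin n → Set
    S⁺ p = S p ⊎ x ~ p

    saturated⁺ : Saturated H S⁺
    saturated⁺ u v (inj₁ Su) uv = inj₁ (saturated S-tc u v Su uv)
    saturated⁺ u v (inj₂ xu) uv = inj₂ (~-trans xu uv)

    connected⁺ : NodeConnected G H S⁺
    connected⁺ = connected-via nodeStep-sym w to-w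
      where
      to-w : ∀ u → S⁺ u → Reach (NodeStep G H S⁺) u w
      to-w u (inj₁ Su) =
        reach-map (λ (Sp , Sq , s) → inj₁ Sp , inj₁ Sq , s) (connected S-tc u w Su (x∈ S-tc))
      to-w u (inj₂ xu) = step (inj₂ xu , inj₁ (x∈ S-tc) , inj₂ (adj-resp xu here xw)) here

    without-x : ∀ {c} → c ~ x → ConnectedWithChord x y (removeNode H S⁺ c)
    without-x {c} cx u v Ru Rv = reach-map lift (connected S-tc u v (into Ru) (into Rv))
      where
      into : ∀ {p} → removeNode H S⁺ c p → S p
      into (inj₁ Sp , _)  = Sp
      into (inj₂ xp , c≁p) = contradiction (~-trans cx xp) c≁p
      back : ∀ {p} → S p → removeNode H S⁺ c p
      back {p} Sp = inj₁ Sp , λ cp → x∉S (saturated S-tc p x Sp (~-trans (~-sym cp) cx))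
      lift : ∀ {p q} → NodeStep G H S p q → ChordStep x y (removeNode H S⁺ c) p q
      lift (Sp , Sq , s) = back Sp , back Sq , inj₁ s

    without-other : ∀ {c} → S c → ¬ c ~ x → ConnectedWithChord x y (removeNode H S⁺ c)
    without-other {c} Sc c≁x = connected-via chordStep-sym x to-x
      where
      x∈R : removeNode H S⁺ c x
      x∈R = inj₂ here , c≁x
      up : ∀ {p} → removeNode H S c p → removeNode H S⁺ c p
      up (Sp , c≁p) = inj₁ Sp , c≁p
      reroute : ∀ {p q} → ChordStep w y (removeNode H S c) p q →
                Reach (ChordStep x y (removeNode H S⁺ c)) p q
      reroute (Rp , Rq , inj₁ s) = step (up Rp , up Rq , inj₁ s) here
      reroute (Rp , Rq , inj₂ (inj₁ (pw , qy))) =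
        step (up Rp , x∈R , inj₁ (inj₂ (adj-resp (~-sym pw) here (adj-sym xw))))
          (step (x∈R , up Rq , inj₂ (inj₁ (here , qy))) here)
      reroute (Rp , Rq , inj₂ (inj₂ (py , qw))) =
        step (up Rp , x∈R , inj₂ (inj₂ (py , here)))
          (step (x∈R , up Rq , inj₁ (inj₂ (adj-resp here (~-sym qw) xw))) here)
      to-x : ∀ u → removeNode H S⁺ c u → Reach (ChordStep x y (removeNode H S⁺ c)) u x
      to-x u (inj₂ xu , c≁u) = step ((inj₂ xu , c≁u) , x∈R , inj₁ (inj₁ (~-sym xu))) here
      to-x u (inj₁ Su , c≁u) with c ~? w
      ... | no c≁w =
        reach-snoc (reach-concatMap reroute (connected-without S-tc c Sc u w (Su , c≁u) (x∈ S-tc , c≁w)))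
                   (up (x∈ S-tc , c≁w) , x∈R , inj₁ (inj₂ (adj-sym xw)))
      ... | yes c~w =
        reach-snoc (reach-concatMap reroute (connected-without S-tc c Sc u y (Su , c≁u) (y∈ S-tc , c≁y)))
                   (up (y∈ S-tc , c≁y) , x∈R , inj₂ (inj₂ (here , here)))
        where
        c≁y : ¬ c ~ y
        c≁y cy = w≁y (~-trans (~-sym c~w) cy)

    extend : TwoConnectedWithChord x y S⁺
    extend = record
      { saturated         = saturated⁺
      ; x∈                = inj₂ here
      ; y∈                = inj₁ (y∈ S-tc)
      ; connected         = connected⁺
      ; connected-without = without
      }
      where
      without : ∀ c → S⁺ c → ConnectedWithChord x y (removeNode H S⁺ c)
      without c S⁺c with c ~? x
      ... | yes cx = without-x cx
      ... | no c≁x = without-other (Sc S⁺c) c≁x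
        where
        Sc : S⁺ c → S c
        Sc (inj₁ Sc′) = Sc′
        Sc (inj₂ xc) = contradiction (~-sym xc) c≁x

  twoNodeConn3 : ∀ {x y z S} → TwoConnectedWithChord x y S → Adj x y → S z → ¬ z ~ x → ¬ z ~ y →
                 TwoNodeConn3 G H S
  twoNodeConn3 {x} {y} {z} S-tc xy Sz z≁x z≁y =
    (x , y , z , x∈ S-tc , y∈ S-tc , Sz , proj₁ xy , z≁x ∘ ~-sym , z≁y ∘ ~-sym) ,
    connected S-tc ,
    λ c Sc u v Ru Rv → reach-map unchord (connected-without S-tc c Sc u v Ru Rv)
    where
    unchord : ∀ {X p q} → ChordStep x y X p q → NodeStep G H X p q
    unchord (Xp , Xq , inj₁ s)                 = Xp , Xq , s
    unchord (Xp , Xq , inj₂ (inj₁ (px , qy))) = Xp , Xq , inj₂ (adj-resp (~-sym px) (~-sym qy) xy)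
    unchord (Xp , Xq , inj₂ (inj₂ (py , qx))) = Xp , Xq , inj₂ (adj-resp (~-sym py) (~-sym qx) (adj-sym xy))

  module Walks (R : Fin n → Fin n → Set) (R⊆G : ∀ {p q} → R p q → Edge G p q) where

    Visits : ∀ {u v} → Reach R u v → Fin n → Set
    Visits {u} here       p = u ~ p
    Visits {u} (step _ W) p = u ~ p ⊎ Visits W p

    visits? : ∀ {u v} (W : Reach R u v) p → Dec (Visits W p)
    visits? {u} here       p = u ~? p
    visits? {u} (step _ W) p = u ~? p ⊎-dec visits? W p

    visits-start : ∀ {u v} (W : Reach R u v) → Visits W u
    visits-start here       = here
    visits-start (step _ W) = inj₁ here

    visits-end : ∀ {u v} (W : Reach R u v) → Visits W v
    visits-end here       = here
    visits-end (step _ W) = inj₂ (visits-end W)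

    visits-resp : ∀ {u v} (W : Reach R u v) {p q} → Visits W p → p ~ q → Visits W q
    visits-resp here       up         pq = ~-trans up pq
    visits-resp (step _ W) (inj₁ up)  pq = inj₁ (~-trans up pq)
    visits-resp (step _ W) (inj₂ Wp)  pq = inj₂ (visits-resp W Wp pq)

    Linked : Fin n → Fin n → Set
    Linked x y = ∃₂ λ p q → x ~ p × y ~ q × R p q

    PathAlong : ∀ {u v} → Reach R u v → Fin n → Fin n → Set₁
    PathAlong W x y = Σ (Fin n → Set) λ S → TwoConnectedWithChord x y S × (∀ p → S p → Visits W p)

    CycleAlong : ∀ {u v} → Reach R u v → Fin n → Fin n → Set₁
    CycleAlong W x y = Σ (Fin n → Set) λ S →
      TwoConnectedWithChord x y S × (∀ p → S p → Visits W p) × ∃ λ z → S z × ¬ z ~ x × ¬ z ~ y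

    pathAlong : ∀ {u v} (W : Reach R u v) → ¬ u ~ v → Linked u v ⊎ CycleAlong W u v → PathAlong W u v
    pathAlong W u≁v (inj₁ (p , q , up , vq , r)) =
      NodePair _ _ , nodePair-twoConnected (u≁v , p , q , up , vq , R⊆G r) , λ where
        p (inj₁ up′) → visits-resp W (visits-start W) up′
        p (inj₂ vp′) → visits-resp W (visits-end W) vp′
    pathAlong W _ (inj₂ (S , S-tc , S⊆W , _)) = S , S-tc , S⊆W

    -- Recursing from the last visit of the walk to the node x, the rest of the walk yields
    -- a path of nodes avoiding x, which x and the chord xy close into a cycle.
    linked-or-cycle : ∀ {u v} (W : Reach R u v) x → Visits W x → ¬ x ~ v → Linked x v ⊎ CycleAlong W x v
    linked-or-cycle here x ux x≁u = contradiction (~-sym ux) x≁u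
    linked-or-cycle (step r W) x Wx x≁v with visits? W x
    ... | yes W′x = map₂ (λ (S , S-tc , S⊆W , third) → S , S-tc , (λ p → inj₂ ∘ S⊆W p) , third)
                         (linked-or-cycle W x W′x x≁v)
    linked-or-cycle (step r W) x (inj₂ W′x) x≁v | no ¬W′x = contradiction W′x ¬W′x
    linked-or-cycle {u} {v} (step {w = w} r W) x (inj₁ ux) x≁v | no ¬W′x with w ~? v
    ... | yes wv  = inj₁ (u , w , ~-sym ux , ~-sym wv , r)
    ... | no w≁v = inj₂ (prepend (pathAlong W w≁v (linked-or-cycle W w (visits-start W) w≁v)))
      where
      x≁w : ¬ x ~ w
      x≁w xw = ¬W′x (visits-resp W (visits-start W) (~-sym xw))
      xw : Adj x w
      xw = x≁w , u , w , ~-sym ux , here , R⊆G r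
      prepend : PathAlong W w v → CycleAlong (step r W) x v
      prepend (S , S-tc , S⊆W) = S⁺ , extend , S⁺⊆W , w , inj₁ (x∈ S-tc) , x≁w ∘ ~-sym , w≁v
        where
        x∉S : ¬ S x
        x∉S = ¬W′x ∘ S⊆W x
        open Extend S-tc x∉S xw w≁v
        S⁺⊆W : ∀ p → S⁺ p → Visits (step r W) p
        S⁺⊆W p (inj₁ Sp) = inj₂ (S⊆W p Sp)
        S⁺⊆W p (inj₂ xp) = inj₁ (~-trans ux xp)

module _ {n : ℕ} (G H : Graph n) {a : Fin n} (trivial : TrivialSegment G H a) where

  StrictExtension : (Fin n → Set) → Set₁
  StrictExtension X = Σ (Fin n → Set) λ Y → Saturated H Y × TwoNodeConn3 G H Y ×
                        (∀ v → X v → Y v) × ∃ λ v → Y v × ¬ X v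

  -- Classically a maximal extension exists; it is reached by well-founded induction on
  -- strict supersets once X is (doubly negatively) represented by a finite subset.
  no-segment-through : (X : Fin n → Set) → Saturated H X → TwoNodeConn3 G H X → X a → ⊥
  no-segment-through X X-sat X-conn Xa =
    ¬¬-subset X λ (s , s⇔X) → go s (⊃-wellFounded s) X s⇔X X-sat X-conn Xa
    where
    go : ∀ s → Acc _⊃_ s → (X : Fin n → Set) → (∀ v → v ∈ s ⇔ X v) →
         Saturated H X → TwoNodeConn3 G H X → X a → ⊥
    go s (acc larger) X s⇔X X-sat X-conn Xa = ¬¬-excluded-middle decide
      where
      open Equivalence
      maximal : ¬ StrictExtension X → ∀ Y → Saturated H Y → TwoNodeConn3 G H Y →
                (∀ v → X v → Y v) → ∀ v → Y v → X v
      maximal ∄Y Y Y-sat Y-conn X⊆Y v Yv with v ∈? s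
      ... | yes v∈s = to (s⇔X v) v∈s
      ... | no  v∉s = contradiction (Y , Y-sat , Y-conn , X⊆Y , v , Yv , v∉s ∘ from (s⇔X v)) ∄Y
      decide : Dec (StrictExtension X) → ⊥
      decide (no ∄Y) = trivial X (X-sat , X-conn , maximal ∄Y) Xa
      decide (yes (Y , Y-sat , Y-conn , X⊆Y , v , Yv , ¬Xv)) = ¬¬-subset Y λ (t , t⇔Y) →
        go t (larger (s⊂t t t⇔Y)) Y t⇔Y Y-sat Y-conn (X⊆Y a Xa)
        where
        s⊂t : ∀ t → (∀ w → w ∈ t ⇔ Y w) → t ⊃ s
        s⊂t t t⇔Y = (λ {w} w∈s → from (t⇔Y w) (X⊆Y w (to (s⇔X w) w∈s))) ,
                    v , from (t⇔Y v) Yv , ¬Xv ∘ to (s⇔X v)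

-- A component of a canonical cover has at least four vertices.
component-escapes : ∀ {n} (H : Graph n) → Canonical H → ∀ c (ps : Fin 3 → Fin n) →
                    ∃ λ v → SameComp H c v × ∀ j → v ≢ ps j
component-escapes {n} H canonical c ps = [ from-cycle , from-edges ]′ (canonical c)
  where
  Escape : Set
  Escape = ∃ λ v → SameComp H c v × ∀ j → v ≢ ps j

  from-cycle : (∃ λ i → 4 ℕ.≤ i × i ℕ.≤ 7 × CompIsCycle H c i) → Escape
  from-cycle (i , 4≤i , _ , f , f-inj , _ , f∈ , _) =
    let (k , f≢) = escape _≟ᶠ_ f f-inj ps 4≤i in f k , f∈ k , f≢

  from-edges : CompAtLeast8Edges H c → Escape
  from-edges (f , f-inj , f-edges) =
    endpoint (pair-escape _≟ᶠ_ f f-inj loopless ps (<-trans (n<1+n 6) (n<1+n 7)))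
    where
    loopless : ∀ e → proj₁ (f e) ≢ proj₂ (f e)
    loopless e u≡v = <-irrefl (cong toℕ u≡v) (proj₁ (f-edges e))
    endpoint : (∃ λ e → (∀ j → proj₁ (f e) ≢ ps j) ⊎ (∀ j → proj₂ (f e) ≢ ps j)) → Escape
    endpoint (e , inj₁ u≢) = proj₁ (f e) , proj₁ (proj₂ (proj₂ (f-edges e))) , u≢
    endpoint (e , inj₂ v≢) = proj₂ (f e) , proj₂ (proj₂ (proj₂ (f-edges e))) , v≢

module Separation {n : ℕ} (G H : Graph n) {a b : Fin n} (ab : NodeAdj G H a b)
                  (trivial : TrivialSegment G H a) where
  open ComponentGraph G H
  open TwoConnectedWithChord

  Between : Fin n → Fin n → Set
  Between x y = Edge G x y × a ~ x × b ~ y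

  between? : ∀ x y → Dec (Between x y)
  between? x y = T? (adj G x y) ×-dec a ~? x ×-dec b ~? y

  open SmallKonig between? public using (Matching3; matching3; CoveredBy; VertexCover2; matching3-or-cover)

  disjoint : ∀ {x y} → a ~ x → b ~ y → x ≢ y
  disjoint ax by refl = proj₁ ab (~-trans ax (~-sym by))

  matching-between : Matching3 → Matching3Between G H a b
  matching-between (matching3 e₀ e₁ e₂ tails-distinct heads-distinct) =
    _ , _ , edges , distinct3-injective tails-distinct , distinct3-injective heads-distinct ,
    λ k l → disjoint (proj₁ (proj₂ (edges k))) (proj₂ (proj₂ (edges l)))
    where
    edges : ∀ k → Between _ _
    edges zero             = e₀
    edges (suc zero)       = e₁
    edges (suc (suc zero)) = e₂

  -- A walk avoiding the cover yields either an a–b edge avoiding it or a cycle of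
  -- \hat G_H through the trivial segment a.
  separated : ∀ {D : Fin n → Set} → CoveredBy D D → ∀ {s t} → a ~ s → b ~ t →
              ¬ Reach (EdgeAvoiding G D) s t
  separated {D} cover {s} {t} as bt W
    with linked-or-cycle W a (visits-resp W (visits-start W) (~-sym as)) (disjoint-nodes ∘ ~-sym)
    where
    open Walks (EdgeAvoiding G D) proj₁
    disjoint-nodes : ¬ t ~ a
    disjoint-nodes ta = proj₁ ab (~-trans (~-sym ta) (~-sym bt))
  ... | inj₁ (p , q , ap , tq , e , ¬Dp , ¬Dq) = [ ¬Dp , ¬Dq ]′ (cover (e , ap , ~-trans bt tq))
  ... | inj₂ (S , S-tc , _ , z , Sz , z≁a , z≁t) =
    no-segment-through G H trivial S (saturated S-tc)
      (twoNodeConn3 S-tc (adj-resp here bt ab) Sz z≁a z≁t) (x∈ S-tc)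

  avoiding : ∀ {v d₁ d₂ d₃ : Fin n} → (∀ j → v ≢ (d₁ ∷ d₂ ∷ d₃ ∷ []) j) → ¬ Pair d₁ d₂ v
  avoiding v≢ = [ v≢ zero , v≢ (suc zero) ]′

  -- Both components have a vertex outside any three given vertices, so a cover of the
  -- a–b edges of size at most two would be a cut vertex or a non-isolating 2-vertex cut.
  no-small-cover : TwoECGraph G → (∀ v → ¬ CutVertex G v) →
                   (∀ u v → TwoVertexCut G u v → TwoCompsOneSmall G (Pair u v) 1) → Canonical H →
                   ¬ VertexCover2
  no-small-cover G-2ec no-cut small-cuts canonical (d₁ , d₂ , cover)
    with component-escapes H canonical a (d₁ ∷ d₂ ∷ d₂ ∷ [])
       | component-escapes H canonical b (d₁ ∷ d₂ ∷ d₂ ∷ [])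
       | d₁ ≟ᶠ d₂
  ... | s , as , s≢ | t , bt , t≢ | yes refl =
    no-cut d₁ (s , t , s≢ zero , t≢ zero , proj₁ (proj₂ G-2ec) s t _ _ ,
               separated cover as bt ∘ reach-map widen)
    where
    widen : ∀ {p q} → EdgeAvoiding G (_≡ d₁) p q → EdgeAvoiding G (Pair d₁ d₁) p q
    widen (e , ¬p , ¬q) = e , [ ¬p , ¬p ]′ , [ ¬q , ¬q ]′
  ... | s , as , s≢ | t , bt , t≢ | no d₁≢d₂ =
    isolated-side (small-cuts d₁ d₂ (d₁≢d₂ , s , t , avoiding s≢ , avoiding t≢ , separated cover as bt))
    where
    isolated-side : ¬ TwoCompsOneSmall G (Pair d₁ d₂) 1
    isolated-side (X , (x₀ , Xx₀) , _ , _ , _ , _ , Y-connected , |X|≤1)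
      with component-escapes H canonical a (d₁ ∷ d₂ ∷ x₀ ∷ [])
         | component-escapes H canonical b (d₁ ∷ d₂ ∷ x₀ ∷ [])
    ... | s′ , as′ , s′≢ | t′ , bt′ , t′≢ =
      separated cover as′ bt′ (Y-connected s′ t′ (in-Y s′≢) (in-Y t′≢))
      where
      in-Y : ∀ {v} → (∀ j → v ≢ (d₁ ∷ d₂ ∷ x₀ ∷ []) j) → ¬ Pair d₁ d₂ v × ¬ T (X v)
      in-Y v≢ = avoiding v≢ , λ Xv → v≢ (suc (suc zero)) (countV≤1-unique X |X|≤1 Xv Xx₀)

proposition6p6 : (ε : ℚ) → 0ℚ < ε → ε ≤ + 1 / 24 →
    {n : ℕ} (G : Graph n) → TwoECGraph G → Structured ε G →
    (H : Graph n) → TwoEdgeCover G H → Bridgeless H → Canonical H →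
    (a b : Fin n) → NodeAdj G H a b → TrivialSegment G H a →
    Matching3Between G H a b
proposition6p6 _ _ _ G G-2ec (no-cut , _ , _ , _ , small-2-cuts , _) H _ _ canonical a b
               ab@(_ , x , y , ax , by , xy) trivial
  = [ matching-between , ⊥-elim ∘ no-small-cover G-2ec no-cut small-2-cuts canonical ]′
      (matching3-or-cover (xy , ax , by))
  where open Separation G H ab trivial
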